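{- For every $\mathrm{cCTL}^*_f$ formula there is an equivalent $\mathrm{cCTL}^*_f$ formula generated by the grammar $\varphi ::= p \mid \neg\varphi \mid \varphi\vee\varphi \mid \mathsf{D}^n\varphi \mid \mathsf{E}\psi$, $\psi ::= \varphi \mid \psi\vee\psi \mid \psi\wedge\psi \mid \mathsf{X}\psi \mid \psi\,\mathsf{U}\,\psi$, where $p$ ranges over atomic propositions and $n$ over $\mathbb N$.
   Context: Trees: a tree $T=(V_T,E_T)$ is a connected acyclic directed graph with root $\epsilon_T$, each node having finitely many but at least one child (unranked, unordered, infinite). A path is a finite or infinite sequence of nodes starting at the root, each element after the first a child of its predecessor; $\pi(i)$ its $i$-th node. Fix a finite set $AP$, $\Sigma=2^{AP}$; a $\Sigma$-tree is $(T,\tau)$ with $\tau:V_T\to\Sigma$. Logic $\mathrm{cCTL}^*_f$: $\varphi ::= \mathsf{D}^n\varphi \mid p \mid \neg\varphi \mid \varphi\vee\varphi \mid \mathsf{E}\varphi \mid \mathsf{X}\varphi \mid \varphi\,\mathsf{U}\,\varphi$ ($\wedge$ as the usual abbreviation), evaluated at a $\Sigma$-tree $\mathcal T$, a finite non-empty path $\pi$ and position $i$: $\mathsf{D}^n\psi$ iff $\pi$ does not end at $\pi(i)$ and there are $n$ distinct finite paths coinciding with $\pi$ up to $i$, pairwise differing at $i+1$, each satisfying $\psi$ at $i+1$; $p$ iff $p\in\tau(\pi(i))$; $\mathsf{E}\psi$ iff some finite path coinciding with $\pi$ up to $i$ satisfies $\psi$ at $i$; $\mathsf{X}\psi$ iff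 $\pi$ does not end at $\pi(i)$ and $\psi$ holds at $i+1$; $\psi\,\mathsf{U}\,\psi'$ iff there is a position $j\ge i$ of $\pi$ with $\psi'$ at $j$ and $\psi$ at all $k$, $i\le k<j$. Two formulas are equivalent if for every $\Sigma$-tree $\mathcal T$ and every finite non-empty path $\pi$, $\mathcal T,\pi,0\models\psi$ iff $\mathcal T,\pi,0\models\psi'$. -}

module Defs where

open import Data.Nat using (ℕ; zero; suc; _≤_; _<_)
open import Data.Fin using (Fin; toℕ)
open import Data.Fin.Subset using (Subset; _∈_)
open import Data.List using (List; []; _∷_; take; length)
open import Data.Maybe using (Maybe; just; nothing)
open import Data.Product using (Σ; ∃; _×_; _,_)
open import Data.Sum using (_⊎_)
open import Data.Unit using (⊤)
open import Relation.Binary.PropositionalEquality using (_≡_)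
open import Relation.Nullary using (¬_)
open import Function.Bundles using (_⇔_)

-- Nodes are the positions reached from the
-- root; distinct child indices give distinct nodes.

record Tree (L : Set) : Set where
  coinductive
  field
    label : L
    arity : ℕ
    child : Fin (suc arity) → Tree L
open Tree public

data Path {L : Set} (t : Tree L) : Set where
  end : Path t
  _∷_ : (c : Fin (suc (arity t))) → Path (child t c) → Path t

-- number of edges: the positions of π are 0 … len π
len : ∀ {L} {t : Tree L} → Path t → ℕ
len end = 0
len (c ∷ π) = suc (len π)

choices : ∀ {L} {t : Tree L} → Path t → List ℕ
choices end = []
choices (c ∷ π) = toℕ c ∷ choices π

-- the node π(i) (as a subtree); only used for i ≤ len π
nodeAt : ∀ {L} {t : Tree L} → Path t → ℕ → Tree L
nodeAt {t = t} π zero = t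
nodeAt {t = t} end (suc i) = t
nodeAt (c ∷ π) (suc i) = nodeAt π i

nth : List ℕ → ℕ → Maybe ℕ
nth [] _ = nothing
nth (x ∷ xs) zero = just x
nth (x ∷ xs) (suc i) = nth xs i

-- π' coincides with π up to position i: both contain positions 0 … i and
-- π'(k) = π(k) for all k ≤ i
Coincide : ∀ {L} {t : Tree L} → ℕ → Path t → Path t → Set
Coincide i π π' = i ≤ len π × i ≤ len π' × take i (choices π) ≡ take i (choices π')

-- π and π' differ at position i+1 (π(i+1) ≠ π'(i+1)), given they agree
-- up to i: the child chosen at step i is different
DifferAtNext : ∀ {L} {t : Tree L} → ℕ → Path t → Path t → Set
DifferAtNext i π π' = ¬ (nth (choices π) i ≡ nth (choices π') i)

infixr 6 _∨'_
infixr 7 _U_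

data Form (m : ℕ) : Set where
  D    : ℕ → Form m → Form m
  atom : Fin m → Form m
  ¬'_  : Form m → Form m
  _∨'_ : Form m → Form m → Form m
  E    : Form m → Form m
  X    : Form m → Form m
  _U_  : Form m → Form m → Form m

_∧'_ : ∀ {m} → Form m → Form m → Form m
φ ∧' ψ = ¬' ((¬' φ) ∨' (¬' ψ))

Sat : ∀ {m} (T : Tree (Subset m)) → Path T → ℕ → Form m → Set
Sat T π i (D n ψ) =
  i < len π ×
  Σ (Fin n → Path T) λ ρ →
    (∀ k → Coincide i π (ρ k) × suc i ≤ len (ρ k) × Sat T (ρ k) (suc i) ψ) ×
    (∀ k l → ¬ (k ≡ l) → DifferAtNext i (ρ k) (ρ l))
Sat T π i (atom p) = p ∈ label (nodeAt π i)
Sat T π i (¬' ψ) = ¬ Sat T π i ψ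
Sat T π i (ψ ∨' ψ') = Sat T π i ψ ⊎ Sat T π i ψ'
Sat T π i (E ψ) = Σ (Path T) λ π' → Coincide i π π' × Sat T π' i ψ
Sat T π i (X ψ) = i < len π × Sat T π (suc i) ψ
Sat T π i (ψ U ψ') =
  Σ ℕ λ j → i ≤ j × j ≤ len π × Sat T π j ψ' ×
    (∀ k → i ≤ k → k < j → Sat T π k ψ)

Equivalent : ∀ {m} → Form m → Form m → Set
Equivalent {m} φ φ' =
  (T : Tree (Subset m)) (π : Path T) → Sat T π 0 φ ⇔ Sat T π 0 φ'

mutual
  data StateF {m : ℕ} : Form m → Set where
    atomS : ∀ p → StateF (atom p)
    negS  : ∀ {φ} → StateF φ → StateF (¬' φ)
    orS   : ∀ {φ φ'} → StateF φ → StateF φ' → StateF (φ ∨' φ')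
    DS    : ∀ n {φ} → StateF φ → StateF (D n φ)
    ES    : ∀ {ψ} → PathF ψ → StateF (E ψ)

  data PathF {m : ℕ} : Form m → Set where
    stateP : ∀ {φ} → StateF φ → PathF φ
    orP    : ∀ {ψ ψ'} → PathF ψ → PathF ψ' → PathF (ψ ∨' ψ')
    andP   : ∀ {ψ ψ'} → PathF ψ → PathF ψ' → PathF (ψ ∧' ψ')
    XP     : ∀ {ψ} → PathF ψ → PathF (X ψ)
    UP     : ∀ {ψ ψ'} → PathF ψ → PathF ψ' → PathF (ψ U ψ')

-- Push negations down to state formulas.  Negations of ∨ and of state
-- formulas stay in the grammar; for the path connectives use the duals
--   ¬ X φ ≡ end ∨ X ¬φ   and   ¬ (φ U ψ) ≡ ¬ψ U ((¬φ ∧ ¬ψ) ∨ (¬ψ ∧ end)),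
-- where "π ends here" is ¬ D⁰ χ for any χ.  The second dual holds classically:
-- if φ U ψ fails, then ψ fails up to the first position where φ fails or π ends.
-- Finally Dⁿ φ ≡ Dⁿ E φ makes the argument of Dⁿ a state formula.
module Submission where

open import Defs
open import Data.Nat using (ℕ)
open import Data.Product using (Σ; _×_)
open import Axiom.ExcludedMiddle using (ExcludedMiddle)
open import Level using (zero)

open import Axiom.DoubleNegationElimination using (em⇒dne)
open import Data.Empty using (⊥-elim)
open import Data.Fin using (Fin)
open import Data.Fin.Subset using (Subset)
open import Data.List using (List; []; _∷_; take)
open import Data.List.Properties using (∷-injective)
open import Data.Maybe using (just)
open import Data.Nat using (suc; _≤_; _<_; _≤‴_; ≤‴-refl; ≤‴-step; _<?_; z≤n)
open import Data.Nat.Properties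
  using (≤-refl; ≤-trans; <⇒≤; ≤‴⇒≤; ≤⇒≤‴; ≮⇒≥; ≤⇒≯; <-≤-trans; m≤n⇒m<n∨m≡n; <-cmp)
open import Data.Product using (_,_; proj₁; proj₂; ∃-syntax)
open import Data.Product.Function.NonDependent.Propositional using (_×-⇔_)
open import Data.Sum using (_⊎_; inj₁; inj₂)
open import Data.Sum.Function.Propositional using (_⊎-⇔_)
open import Function using (_∘_)
open import Function.Bundles using (_⇔_; mk⇔; Equivalence)
import Function.Properties.Equivalence as ⇔
open import Relation.Binary using (tri<; tri≈; tri>)
open import Relation.Binary.PropositionalEquality using (_≡_; refl; sym; trans; cong; cong₂)
open import Relation.Nullary using (¬_; yes; no; contradiction; contraposition; _¬-⊎_)

open Equivalence using (to; from)

private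
  variable
    m n i : ℕ
    T : Tree (Subset m)
    π π' π'' : Path T
    φ φ' ψ ψ' χ : Form m
    P P' Q Q' : ℕ → Set

Until : (P Q : ℕ → Set) (n : ℕ) → ℕ → Set
Until P Q n i = ∃[ j ] i ≤ j × j ≤ n × Q j × (∀ k → i ≤ k → k < j → P k)

Release : (P Q : ℕ → Set) (n : ℕ) → ℕ → Set
Release P Q n = Until (¬_ ∘ Q) (λ j → ¬ P j × ¬ Q j ⊎ ¬ Q j × n ≤ j) n

Until-now : i ≤ n → Q i → Until P Q n i
Until-now i≤n q = _ , ≤-refl , i≤n , q , λ k i≤k k<i → ⊥-elim (≤⇒≯ i≤k k<i)

Until-step : P i → Until P Q n (suc i) → Until P Q n i
Until-step {P = P} {i = i} p (j , i<j , j≤n , q , before) = j , <⇒≤ i<j , j≤n , q , earlier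
  where
  earlier : ∀ k → i ≤ k → k < j → P k
  earlier k i≤k k<j with m≤n⇒m<n∨m≡n i≤k
  ... | inj₁ i<k = before k i<k k<j
  ... | inj₂ refl = p

Until-map : (∀ {k} → k ≤ n → P k → P' k) → (∀ {k} → k ≤ n → Q k → Q' k) →
            Until P Q n i → Until P' Q' n i
Until-map f g (j , i≤j , j≤n , q , before) =
  j , i≤j , j≤n , g j≤n q , λ k i≤k k<j → f (≤-trans (<⇒≤ k<j) j≤n) (before k i≤k k<j)

Until-cong : (∀ {k} → k ≤ n → P k ⇔ P' k) → (∀ {k} → k ≤ n → Q k ⇔ Q' k) →
             Until P Q n i ⇔ Until P' Q' n i
Until-cong P⇔P' Q⇔Q' =
  mk⇔ (Until-map (to ∘ P⇔P') (to ∘ Q⇔Q')) (Until-map (from ∘ P⇔P') (from ∘ Q⇔Q'))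

Release⇒¬Until : Release P Q n i → ¬ Until P Q n i
Release⇒¬Until (j , i≤j , _ , stop , ¬q) (j' , i≤j' , j'≤n , q , p) with <-cmp j' j | stop
... | tri< j'<j _ _ | _ = ¬q j' i≤j' j'<j q
... | tri≈ _ refl _ | inj₁ (_ , ¬q') = ¬q' q
... | tri≈ _ refl _ | inj₂ (¬q' , _) = ¬q' q
... | tri> _ _ j<j' | inj₁ (¬p , _) = ¬p (p j i≤j j<j')
... | tri> _ _ j<j' | inj₂ (_ , n≤j) = ≤⇒≯ n≤j (<-≤-trans j<j' j'≤n)

¬Until⇒Release : ExcludedMiddle Level.zero → i ≤‴ n → ¬ Until P Q n i → Release P Q n i
¬Until⇒Release {i = i} {Q = Q} em i≤n ¬until with em {Q i}
... | yes q = ⊥-elim (¬until (Until-now (≤‴⇒≤ i≤n) q))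
¬Until⇒Release em ≤‴-refl ¬until | no ¬q = Until-now ≤-refl (inj₂ (¬q , ≤-refl))
¬Until⇒Release {i = i} {P = P} em (≤‴-step i<n) ¬until | no ¬q with em {P i}
... | no ¬p = Until-now (≤‴⇒≤ (≤‴-step i<n)) (inj₁ (¬p , ¬q))
... | yes p = Until-step ¬q (¬Until⇒Release em i<n (¬until ∘ Until-step p))

¬Until⇔Release : ExcludedMiddle Level.zero → i ≤ n → (¬ Until P Q n i) ⇔ Release P Q n i
¬Until⇔Release em i≤n = mk⇔ (¬Until⇒Release em (≤⇒≤‴ i≤n)) Release⇒¬Until

take-suc≡⇒take≡ : ∀ {A : Set} i (xs ys : List A) →
                  take (suc i) xs ≡ take (suc i) ys → take i xs ≡ take i ys
take-suc≡⇒take≡ 0 _ _ _ = refl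
take-suc≡⇒take≡ (suc i) [] [] _ = refl
take-suc≡⇒take≡ (suc i) [] (y ∷ ys) ()
take-suc≡⇒take≡ (suc i) (x ∷ xs) [] ()
take-suc≡⇒take≡ (suc i) (x ∷ xs) (y ∷ ys) e =
  cong₂ _∷_ (proj₁ (∷-injective e)) (take-suc≡⇒take≡ i xs ys (proj₂ (∷-injective e)))

take-suc≡⇒nth≡ : ∀ i (xs ys : List ℕ) → take (suc i) xs ≡ take (suc i) ys → nth xs i ≡ nth ys i
take-suc≡⇒nth≡ _ [] [] _ = refl
take-suc≡⇒nth≡ _ [] (y ∷ ys) ()
take-suc≡⇒nth≡ _ (x ∷ xs) [] ()
take-suc≡⇒nth≡ 0 (x ∷ xs) (y ∷ ys) e = cong just (proj₁ (∷-injective e))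
take-suc≡⇒nth≡ (suc i) (x ∷ xs) (y ∷ ys) e = take-suc≡⇒nth≡ i xs ys (proj₂ (∷-injective e))

Coincide-refl : i ≤ len π → Coincide i π π
Coincide-refl i≤len = i≤len , i≤len , refl

Coincide-trans : Coincide i π π' → Coincide i π' π'' → Coincide i π π''
Coincide-trans (i≤π , _ , e) (_ , i≤π'' , e') = i≤π , i≤π'' , trans e e'

Coincide-suc⇒Coincide : Coincide (suc i) π π' → Coincide i π π'
Coincide-suc⇒Coincide {i = i} {π = π} {π' = π'} (i<π , i<π' , e) =
  <⇒≤ i<π , <⇒≤ i<π' , take-suc≡⇒take≡ i (choices π) (choices π') e

Coincide-suc⇒nth≡ : Coincide (suc i) π π' → nth (choices π) i ≡ nth (choices π') i
Coincide-suc⇒nth≡ {i = i} {π = π} {π' = π'} (_ , _ , e) = take-suc≡⇒nth≡ i (choices π) (choices π') e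

infix 4 _⊑_ _≋_

record _⊑_ (φ ψ : Form m) : Set where
  constructor mk⊑
  field
    sat⇒ : ∀ {T : Tree (Subset m)} (π : Path T) {i} → i ≤ len π → Sat T π i φ → Sat T π i ψ

-- Positions past the end of π are excluded: Sat is junk there, and the
-- release law below fails at them.
record _≋_ (φ ψ : Form m) : Set where
  constructor mk≋
  field
    sat⇔ : ∀ {T : Tree (Subset m)} (π : Path T) {i} → i ≤ len π → Sat T π i φ ⇔ Sat T π i ψ

⊑-antisym : φ ⊑ ψ → ψ ⊑ φ → φ ≋ ψ
⊑-antisym (mk⊑ φ⇒ψ) (mk⊑ ψ⇒φ) = mk≋ λ π i≤π → mk⇔ (φ⇒ψ π i≤π) (ψ⇒φ π i≤π)

≋⇒⊑ : φ ≋ ψ → φ ⊑ ψ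
≋⇒⊑ (mk≋ φ⇔ψ) = mk⊑ λ π i≤π → to (φ⇔ψ π i≤π)

≋⇒⊒ : φ ≋ ψ → ψ ⊑ φ
≋⇒⊒ (mk≋ φ⇔ψ) = mk⊑ λ π i≤π → from (φ⇔ψ π i≤π)

≋-refl : φ ≋ φ
≋-refl = mk≋ λ _ _ → ⇔.refl

≋-trans : φ ≋ ψ → ψ ≋ χ → φ ≋ χ
≋-trans (mk≋ φ⇔ψ) (mk≋ ψ⇔χ) = mk≋ λ π i≤π → ⇔.trans (φ⇔ψ π i≤π) (ψ⇔χ π i≤π)

¬-cong : φ ≋ φ' → ¬' φ ≋ ¬' φ'
¬-cong (mk≋ φ⇔φ') = mk≋ λ π i≤π →
  mk⇔ (contraposition (from (φ⇔φ' π i≤π))) (contraposition (to (φ⇔φ' π i≤π)))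

∨-cong : φ ≋ φ' → ψ ≋ ψ' → φ ∨' ψ ≋ φ' ∨' ψ'
∨-cong (mk≋ φ⇔φ') (mk≋ ψ⇔ψ') = mk≋ λ π i≤π → φ⇔φ' π i≤π ⊎-⇔ ψ⇔ψ' π i≤π

∧-cong : φ ≋ φ' → ψ ≋ ψ' → φ ∧' ψ ≋ φ' ∧' ψ'
∧-cong φ≋φ' ψ≋ψ' = ¬-cong (∨-cong (¬-cong φ≋φ') (¬-cong ψ≋ψ'))

X-mono : φ ⊑ φ' → X φ ⊑ X φ'
X-mono (mk⊑ φ⇒φ') = mk⊑ λ π _ (i<π , s) → i<π , φ⇒φ' π i<π s

X-cong : φ ≋ φ' → X φ ≋ X φ'
X-cong φ≋φ' = ⊑-antisym (X-mono (≋⇒⊑ φ≋φ')) (X-mono (≋⇒⊒ φ≋φ'))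

U-cong : φ ≋ φ' → ψ ≋ ψ' → φ U ψ ≋ φ' U ψ'
U-cong (mk≋ φ⇔φ') (mk≋ ψ⇔ψ') = mk≋ λ π _ → Until-cong (φ⇔φ' π) (ψ⇔ψ' π)

E-mono : φ ⊑ φ' → E φ ⊑ E φ'
E-mono (mk⊑ φ⇒φ') = mk⊑ λ _ _ (π' , co@(_ , i≤π' , _) , s) → π' , co , φ⇒φ' π' i≤π' s

E-cong : φ ≋ φ' → E φ ≋ E φ'
E-cong φ≋φ' = ⊑-antisym (E-mono (≋⇒⊑ φ≋φ')) (E-mono (≋⇒⊒ φ≋φ'))

E-intro : φ ⊑ E φ
E-intro = mk⊑ λ π i≤π s → π , Coincide-refl i≤π , s

D-mono : φ ⊑ φ' → D n φ ⊑ D n φ'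
D-mono (mk⊑ φ⇒φ') = mk⊑ λ _ _ (i<π , ρ , branch , apart) →
  i<π , ρ , (λ k → let (co , i<ρ , s) = branch k in co , i<ρ , φ⇒φ' (ρ k) i<ρ s) , apart

D-cong : φ ≋ φ' → D n φ ≋ D n φ'
D-cong φ≋φ' = ⊑-antisym (D-mono (≋⇒⊑ φ≋φ')) (D-mono (≋⇒⊒ φ≋φ'))

-- Each branch ρ k is replaced by the witness of E φ at i+1, which agrees
-- with ρ k up to i+1: so the new branches still leave π at i+1 and are
-- still pairwise apart there.
D-E-elim : D n (E φ) ⊑ D n φ
D-E-elim {n = n} {φ = φ} = mk⊑ replace
  where
  replace : ∀ {T} (π : Path T) {i} → i ≤ len π → Sat T π i (D n (E φ)) → Sat T π i (D n φ)
  replace {T} π {i} _ (i<π , ρ , branch , apart) = i<π , ρ' , branch' , apart'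
    where
    witness : ∀ k → Σ (Path T) λ π' → Coincide (suc i) (ρ k) π' × Sat T π' (suc i) φ
    witness k = proj₂ (proj₂ (branch k))

    ρ' : Fin n → Path T
    ρ' k = proj₁ (witness k)

    ρ≈ρ' : ∀ k → Coincide (suc i) (ρ k) (ρ' k)
    ρ≈ρ' k = proj₁ (proj₂ (witness k))

    branch' : ∀ k → Coincide i π (ρ' k) × suc i ≤ len (ρ' k) × Sat T (ρ' k) (suc i) φ
    branch' k = Coincide-trans (proj₁ (branch k)) (Coincide-suc⇒Coincide (ρ≈ρ' k)) ,
                proj₁ (proj₂ (ρ≈ρ' k)) , proj₂ (proj₂ (witness k))

    apart' : ∀ k l → ¬ k ≡ l → DifferAtNext i (ρ' k) (ρ' l)
    apart' k l k≢l same = apart k l k≢l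
      (trans (Coincide-suc⇒nth≡ (ρ≈ρ' k)) (trans same (sym (Coincide-suc⇒nth≡ (ρ≈ρ' l)))))

D≋D-E : D n φ ≋ D n (E φ)
D≋D-E = ⊑-antisym (D-mono E-intro) D-E-elim

-- D⁰ χ only says that π continues past the current position; χ is a
-- placeholder, needed because there may be no atoms to build a formula from.
ended : Form m → Form m
ended χ = ¬' D 0 χ

sat-ended : Sat T π i (ended χ) ⇔ len π ≤ i
sat-ended = mk⇔ (λ ¬D → ≮⇒≥ λ i<π → ¬D (i<π , (λ ()) , (λ ()) , λ ()))
                (λ π≤i (i<π , _) → ≤⇒≯ π≤i i<π)

sat-¬∧¬ : Sat T π i ((¬' φ) ∧' (¬' ψ)) ⇔ (¬ Sat T π i φ × ¬ Sat T π i ψ)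
sat-¬∧¬ = mk⇔ (λ h → h ∘ inj₁ ∘ contradiction , h ∘ inj₂ ∘ contradiction)
              (λ (¬s , ¬t) → contradiction ¬s ¬-⊎ contradiction ¬t)

¬¬-law : ExcludedMiddle Level.zero → ¬' ¬' φ ≋ φ
¬¬-law em = mk≋ λ _ _ → mk⇔ (em⇒dne em) contradiction

¬∨-law : ¬' (φ ∨' ψ) ≋ (¬' φ) ∧' (¬' ψ)
¬∨-law = mk≋ λ _ _ →
  ⇔.trans (mk⇔ (λ h → h ∘ inj₁ , h ∘ inj₂) (λ (¬s , ¬t) → ¬s ¬-⊎ ¬t)) (⇔.sym sat-¬∧¬)

¬X-law : ¬' X φ ≋ ended χ ∨' X (¬' φ)
¬X-law {φ = φ} {χ = χ} = mk≋ λ π _ → mk⇔ (split π) (join π)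
  where
  split : ∀ {T} (π : Path T) {i} → ¬ Sat T π i (X φ) → Sat T π i (ended χ ∨' X (¬' φ))
  split π {i} ¬next with i <? len π
  ... | yes i<π = inj₂ (i<π , ¬next ∘ (i<π ,_))
  ... | no i≮π = inj₁ (from sat-ended (≮⇒≥ i≮π))

  join : ∀ {T} (π : Path T) {i} → Sat T π i (ended χ ∨' X (¬' φ)) → ¬ Sat T π i (X φ)
  join π (inj₁ ends) (i<π , _) = ≤⇒≯ (to sat-ended ends) i<π
  join π (inj₂ (_ , ¬s)) (_ , s) = ¬s s

release-law : ExcludedMiddle Level.zero →
              ¬' (φ U ψ) ≋ ¬' ψ U (((¬' φ) ∧' (¬' ψ)) ∨' ((¬' ψ) ∧' ended χ))
release-law {ψ = ψ} {χ = χ} em = mk≋ λ π i≤π → ⇔.trans (¬Until⇔Release em i≤π)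
  (Until-cong (λ _ → ⇔.refl) λ _ → ⇔.sym (sat-¬∧¬ ⊎-⇔ ⇔.trans (sat-¬∧¬ {φ = ψ} {ψ = D 0 χ})
                                                              (⇔.refl ×-⇔ sat-ended {χ = χ})))

mutual
  nnf : Form m → Form m
  nnf (D n φ) = D n (E (nnf φ))
  nnf (atom p) = atom p
  nnf (¬' φ) = nnf¬ φ
  nnf (φ ∨' ψ) = nnf φ ∨' nnf ψ
  nnf (E φ) = E (nnf φ)
  nnf (X φ) = X (nnf φ)
  nnf (φ U ψ) = nnf φ U nnf ψ

  nnf¬ : Form m → Form m
  nnf¬ (¬' φ) = nnf φ
  nnf¬ (φ ∨' ψ) = nnf¬ φ ∧' nnf¬ ψ
  nnf¬ (X φ) = ended (E (nnf φ)) ∨' X (nnf¬ φ)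
  nnf¬ (φ U ψ) = nnf¬ ψ U ((nnf¬ φ ∧' nnf¬ ψ) ∨' (nnf¬ ψ ∧' ended (E (nnf ψ))))
  nnf¬ φ = ¬' nnf φ

ended-stateF : PathF φ → StateF (ended (E φ))
ended-stateF ψ = negS (DS 0 (ES ψ))

mutual
  nnf-pathF : (φ : Form m) → PathF (nnf φ)
  nnf-pathF (D n φ) = stateP (DS n (ES (nnf-pathF φ)))
  nnf-pathF (atom p) = stateP (atomS p)
  nnf-pathF (¬' φ) = nnf¬-pathF φ
  nnf-pathF (φ ∨' ψ) = orP (nnf-pathF φ) (nnf-pathF ψ)
  nnf-pathF (E φ) = stateP (ES (nnf-pathF φ))
  nnf-pathF (X φ) = XP (nnf-pathF φ)
  nnf-pathF (φ U ψ) = UP (nnf-pathF φ) (nnf-pathF ψ)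

  nnf¬-pathF : (φ : Form m) → PathF (nnf¬ φ)
  nnf¬-pathF (D n φ) = stateP (negS (DS n (ES (nnf-pathF φ))))
  nnf¬-pathF (atom p) = stateP (negS (atomS p))
  nnf¬-pathF (¬' φ) = nnf-pathF φ
  nnf¬-pathF (φ ∨' ψ) = andP (nnf¬-pathF φ) (nnf¬-pathF ψ)
  nnf¬-pathF (E φ) = stateP (negS (ES (nnf-pathF φ)))
  nnf¬-pathF (X φ) = orP (stateP (ended-stateF (nnf-pathF φ))) (XP (nnf¬-pathF φ))
  nnf¬-pathF (φ U ψ) =
    UP (nnf¬-pathF ψ) (orP (andP (nnf¬-pathF φ) (nnf¬-pathF ψ))
                           (andP (nnf¬-pathF ψ) (stateP (ended-stateF (nnf-pathF ψ)))))

module _ (em : ExcludedMiddle Level.zero) where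

  mutual
    nnf-correct : (φ : Form m) → φ ≋ nnf φ
    nnf-correct (D n φ) = ≋-trans (D-cong (nnf-correct φ)) D≋D-E
    nnf-correct (atom p) = ≋-refl
    nnf-correct (¬' φ) = nnf¬-correct φ
    nnf-correct (φ ∨' ψ) = ∨-cong (nnf-correct φ) (nnf-correct ψ)
    nnf-correct (E φ) = E-cong (nnf-correct φ)
    nnf-correct (X φ) = X-cong (nnf-correct φ)
    nnf-correct (φ U ψ) = U-cong (nnf-correct φ) (nnf-correct ψ)

    nnf¬-correct : (φ : Form m) → ¬' φ ≋ nnf¬ φ
    nnf¬-correct (D n φ) = ¬-cong (nnf-correct (D n φ))
    nnf¬-correct (atom p) = ≋-refl
    nnf¬-correct (¬' φ) = ≋-trans (¬¬-law em) (nnf-correct φ)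
    nnf¬-correct (φ ∨' ψ) = ≋-trans ¬∨-law (∧-cong (nnf¬-correct φ) (nnf¬-correct ψ))
    nnf¬-correct (E φ) = ¬-cong (nnf-correct (E φ))
    nnf¬-correct (X φ) = ≋-trans ¬X-law (∨-cong ≋-refl (X-cong (nnf¬-correct φ)))
    nnf¬-correct (φ U ψ) =
      ≋-trans (release-law em)
              (U-cong (nnf¬-correct ψ) (∨-cong (∧-cong (nnf¬-correct φ) (nnf¬-correct ψ))
                                               (∧-cong (nnf¬-correct ψ) ≋-refl)))

lemma3 : ExcludedMiddle Level.zero →
    ∀ {m : ℕ} (φ : Form m) → Σ (Form m) λ φ' → PathF φ' × Equivalent φ φ'
lemma3 em φ = nnf φ , nnf-pathF φ , λ T π → _≋_.sat⇔ (nnf-correct em φ) π z≤n
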